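{- Let $k\ge 3$ be an integer and let $H$ be a subgraph of the star $K_{1,k}$. Then $$\operatorname{bgr}_k(P_4:H)=\lceil \sqrt{k}\rceil.$$
   Context: All graphs are finite, simple and without isolated vertices (in particular $H$ is non-empty). $P_n$ is the path on $n$ vertices. A $k$-edge-coloring of a graph is a map from its edge set onto $\{1,\dots,k\}$ that is exact, i.e. every one of the $k$ colors is used at least once. An edge-colored graph is rainbow if all its edges have distinct colors and monochromatic if all its edges have the same color. For non-empty bipartite graphs $G,H$ and a positive integer $k$, the bipartite Gallai-Ramsey number $\operatorname{bgr}_k(G:H)$ is the minimum integer $N$ such that for all $n\ge N$, every (exact) $k$-edge-coloring of the complete bipartite graph $K_{n,n}$ contains a rainbow subgraph isomorphic to $G$ or a monochromatic subgraph isomorphic to $H$. -}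

module Defs where

open import Data.Nat using (ℕ; zero; suc; _*_; _∸_; _≤_; _<_)
open import Data.Fin using (Fin; toℕ; zero; suc)
open import Data.Sum using (_⊎_; inj₁; inj₂)
open import Data.Product using (Σ; ∃; ∃-syntax; _×_; _,_)
open import Relation.Binary.PropositionalEquality using (_≡_; refl)
open import Relation.Nullary using (¬_)
open import Data.Empty using (⊥)
open import Function.Definitions using (Injective)

record Graph : Set₁ where
  field
    V       : ℕ
    E       : Fin V → Fin V → Set
    sym     : ∀ {u v} → E u v → E v u
    irrefl  : ∀ {u} → ¬ E u u
    noIsol  : ∀ u → ∃[ v ] E u v
open Graph public

StarEdge : (k : ℕ) → Fin (suc k) → Fin (suc k) → Set
StarEdge k u v = (toℕ u ≡ 0 × ¬ toℕ v ≡ 0) ⊎ (¬ toℕ u ≡ 0 × toℕ v ≡ 0)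

SubgraphOfStar : Graph → ℕ → Set
SubgraphOfStar H k = Σ (Fin (V H) → Fin (suc k)) λ f →
  Injective _≡_ _≡_ f × (∀ {u v} → E H u v → StarEdge k (f u) (f v))

P4Edge : Fin 4 → Fin 4 → Set
P4Edge u v = suc (toℕ u) ≡ toℕ v ⊎ suc (toℕ v) ≡ toℕ u

P4 : Graph
P4 = record
  { V = 4 ; E = P4Edge
  ; sym = λ { (inj₁ p) → inj₂ p ; (inj₂ p) → inj₁ p }
  ; irrefl = irr ; noIsol = noI }
  where
  irr : ∀ {u} → ¬ P4Edge u u
  irr {zero} (inj₁ ()) ; irr {zero} (inj₂ ())
  irr {suc zero} (inj₁ ()) ; irr {suc zero} (inj₂ ())
  irr {suc (suc zero)} (inj₁ ()) ; irr {suc (suc zero)} (inj₂ ())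
  irr {suc (suc (suc zero))} (inj₁ ()) ; irr {suc (suc (suc zero))} (inj₂ ())
  noI : ∀ u → ∃[ v ] P4Edge u v
  noI zero = suc zero , inj₁ refl
  noI (suc zero) = zero , inj₂ refl
  noI (suc (suc zero)) = suc zero , inj₂ refl
  noI (suc (suc (suc zero))) = suc (suc zero) , inj₂ refl

-- Edge-colourings of K_{n,n}.  Vertices are Fin n ⊎ Fin n (left/right
-- classes); the edge {inj₁ i, inj₂ j} gets colour c i j.

Colouring : ℕ → ℕ → Set
Colouring n k = Fin n → Fin n → Fin k

Exact : ∀ {n k} → Colouring n k → Set
Exact {n} {k} c = ∀ (col : Fin k) → ∃[ i ] ∃[ j ] c i j ≡ col

ColouredEdge : ∀ {n k} → Colouring n k → (x y : Fin n ⊎ Fin n) → Fin k → Set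
ColouredEdge c (inj₁ i) (inj₂ j) col = c i j ≡ col
ColouredEdge c (inj₂ j) (inj₁ i) col = c i j ≡ col
ColouredEdge c (inj₁ _) (inj₁ _) col = ⊥
ColouredEdge c (inj₂ _) (inj₂ _) col = ⊥

record Copy {n k} (c : Colouring n k) (G : Graph) : Set where
  field
    map    : Fin (V G) → Fin n ⊎ Fin n
    inj    : Injective _≡_ _≡_ map
    colour : ∀ {u v} → E G u v → Fin k
    isEdge : ∀ {u v} (e : E G u v) → ColouredEdge c (map u) (map v) (colour e)
open Copy public

Rainbow : ∀ {n k} {c : Colouring n k} {G : Graph} → Copy c G → Set
Rainbow {G = G} cp = ∀ {u v u' v'} (e : E G u v) (e' : E G u' v') →
  colour cp e ≡ colour cp e' → (u ≡ u' × v ≡ v') ⊎ (u ≡ v' × v ≡ u')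

Monochromatic : ∀ {n k} {c : Colouring n k} {G : Graph} → Copy c G → Set
Monochromatic {k = k} {G = G} cp = ∃[ col ] ∀ {u v} (e : E G u v) → colour cp e ≡ col

Arrows : ℕ → ℕ → Graph → Graph → Set
Arrows n k G H = (c : Colouring n k) → Exact c →
  (Σ (Copy c G) Rainbow) ⊎ (Σ (Copy c H) Monochromatic)

ArrowsFrom : ℕ → ℕ → Graph → Graph → Set
ArrowsFrom N k G H = ∀ n → N ≤ n → Arrows n k G H

-- N = bgr_k(G:H): N is the least integer, among those N for which
-- K_{N,N} admits an exact k-colouring (k ≤ N*N), with ArrowsFrom N.
IsBgr : ℕ → Graph → Graph → ℕ → Set
IsBgr k G H N =
  k ≤ N * N × ArrowsFrom N k G H ×
  (∀ M → k ≤ M * M → ArrowsFrom M k G H → N ≤ M)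

-- N = ⌈√k⌉  (for k ≥ 1): (N-1)^2 < k ≤ N^2
IsCeilSqrt : ℕ → ℕ → Set
IsCeilSqrt k N = (N ∸ 1) * (N ∸ 1) < k × k ≤ N * N

{-# OPTIONS --safe #-}
-- If some row and some column of an exact colouring of K_{n,n} are non-constant, a short case
-- analysis using a third colour yields a rainbow path q–a–q′–p through two rows and two columns.
-- Otherwise, up to transposition, every row is constant; then the k colours sit on k distinct
-- rows, so k ≤ n and any row is a monochromatic K_{1,n}, which contains H ⊆ K_{1,k}.
-- This holds for every n, so the least admissible N is the least one with k ≤ N², i.e. ⌈√k⌉.
module Submission where

open import Defs hiding (sym)
open import Data.Nat using (ℕ; zero; suc; _*_; _≤_; s≤s)
open import Data.Nat.Properties using (suc-injective; ≤-trans; *-mono-≤; ≮⇒≥; <⇒≱; <⇒≤pred)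
open import Data.Fin using (Fin; zero; suc; toℕ; inject₁; inject≤; _≟_)
open import Data.Fin.Properties using (all?; ¬∀⟶∃¬; injective⇒≤; inject≤-injective; toℕ-injective; toℕ-inject₁)
open import Data.Sum using (_⊎_; inj₁; inj₂; swap)
open import Data.Sum.Properties using (swap-involutive; inj₂-injective)
open import Data.Product using (Σ; ∃₂; ∃-syntax; _×_; _,_; proj₁; proj₂)
open import Relation.Binary.Definitions using (DecidableEquality)
open import Relation.Binary.PropositionalEquality using (_≡_; _≢_; refl; sym; trans; cong; module ≡-Reasoning)
open import Relation.Nullary using (¬_; Dec; yes; no)
open import Data.Empty using (⊥-elim)
open import Data.Vec.Functional using ([]; _∷_)
open import Function.Definitions using (Injective)

data PathEdge {m : ℕ} : Fin (suc m) → Fin (suc m) → Set where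
  forth : (i : Fin m) → PathEdge (inject₁ i) (suc i)
  back  : (i : Fin m) → PathEdge (suc i) (inject₁ i)

edgeIndex : ∀ {m} {u v : Fin (suc m)} → PathEdge u v → Fin m
edgeIndex (forth i) = i
edgeIndex (back i)  = i

reverse : ∀ {m} {u v : Fin (suc m)} → PathEdge u v → PathEdge v u
reverse (forth i) = back i
reverse (back i)  = forth i

successor⇒pathEdge : ∀ {m} {u v : Fin (suc m)} → suc (toℕ u) ≡ toℕ v → PathEdge u v
successor⇒pathEdge {v = suc i} p
  with toℕ-injective (trans (suc-injective p) (sym (toℕ-inject₁ i)))
... | refl = forth i

pathEdge : ∀ {m} {u v : Fin (suc m)} →
           suc (toℕ u) ≡ toℕ v ⊎ suc (toℕ v) ≡ toℕ u → PathEdge u v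
pathEdge (inj₁ p) = successor⇒pathEdge p
pathEdge (inj₂ p) = reverse (successor⇒pathEdge p)

sameIndex⇒sameEdge : ∀ {m} {u v u′ v′ : Fin (suc m)} (e : PathEdge u v) (e′ : PathEdge u′ v′) →
  edgeIndex e ≡ edgeIndex e′ → (u ≡ u′ × v ≡ v′) ⊎ (u ≡ v′ × v ≡ u′)
sameIndex⇒sameEdge (forth i) (forth i) refl = inj₁ (refl , refl)
sameIndex⇒sameEdge (forth i) (back i)  refl = inj₂ (refl , refl)
sameIndex⇒sameEdge (back i)  (forth i) refl = inj₂ (refl , refl)
sameIndex⇒sameEdge (back i)  (back i)  refl = inj₁ (refl , refl)

ColouredEdge-sym : ∀ {n k} (c : Colouring n k) {x y : Fin n ⊎ Fin n} {col : Fin k} →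
                   ColouredEdge c x y col → ColouredEdge c y x col
ColouredEdge-sym c {inj₁ _} {inj₂ _} e = e
ColouredEdge-sym c {inj₂ _} {inj₁ _} e = e

transpose : ∀ {n k} → Colouring n k → Colouring n k
transpose c i j = c j i

transpose-exact : ∀ {n k} {c : Colouring n k} → Exact c → Exact (transpose c)
transpose-exact ex col with ex col
... | i , j , cij≡col = j , i , cij≡col

transpose-edge : ∀ {n k} (c : Colouring n k) (x y : Fin n ⊎ Fin n) {col : Fin k} →
                 ColouredEdge (transpose c) x y col → ColouredEdge c (swap x) (swap y) col
transpose-edge c (inj₁ _) (inj₂ _) e = e
transpose-edge c (inj₂ _) (inj₁ _) e = e

swap-injective : {A B : Set} → Injective _≡_ _≡_ (swap {A = A} {B = B})
swap-injective {x = x} {y} eq = begin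
  x               ≡⟨ swap-involutive x ⟨
  swap (swap x)   ≡⟨ cong swap eq ⟩
  swap (swap y)   ≡⟨ swap-involutive y ⟩
  y               ∎
  where open ≡-Reasoning

transpose-copy : ∀ {n k} {c : Colouring n k} {G : Graph} → Copy (transpose c) G → Copy c G
transpose-copy {c = c} cp = record
  { map    = λ u → swap (map cp u)
  ; inj    = λ eq → inj cp (swap-injective eq)
  ; colour = colour cp
  ; isEdge = λ {u} {v} e → transpose-edge c (map cp u) (map cp v) (isEdge cp e)
  }

transpose-monochromatic : ∀ {n k} {c : Colouring n k} {G : Graph} →
  Σ (Copy (transpose c) G) Monochromatic → Σ (Copy c G) Monochromatic
transpose-monochromatic (copy , mono) = transpose-copy copy , mono

rainbowPath : ∀ {n k} (c : Colouring n k) (w : Fin 4 → Fin n ⊎ Fin n) → Injective _≡_ _≡_ w →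
  (κ : Fin 3 → Fin k) → Injective _≡_ _≡_ κ →
  (∀ i → ColouredEdge c (w (inject₁ i)) (w (suc i)) (κ i)) → Σ (Copy c P4) Rainbow
rainbowPath c w w-inj κ κ-inj walk = copy , rainbow
  where
  along : ∀ {u v} (e : PathEdge u v) → ColouredEdge c (w u) (w v) (κ (edgeIndex e))
  along (forth i) = walk i
  along (back i)  = ColouredEdge-sym c (walk i)

  copy : Copy c P4
  copy = record
    { map    = w
    ; inj    = w-inj
    ; colour = λ e → κ (edgeIndex (pathEdge e))
    ; isEdge = λ e → along (pathEdge e)
    }

  rainbow : Rainbow copy
  rainbow e e′ eq = sameIndex⇒sameEdge (pathEdge e) (pathEdge e′) (κ-inj eq)

distinct-injective : {A : Set} {a b c : A} → a ≢ b → a ≢ c → b ≢ c →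
                     Injective _≡_ _≡_ (a ∷ b ∷ c ∷ [])
distinct-injective {a = a} {b} {c} a≢b a≢c b≢c {x} {y} = injective x y
  where
  injective : ∀ x y → (a ∷ b ∷ c ∷ []) x ≡ (a ∷ b ∷ c ∷ []) y → x ≡ y
  injective zero             zero             _  = refl
  injective zero             (suc zero)       eq = ⊥-elim (a≢b eq)
  injective zero             (suc (suc zero)) eq = ⊥-elim (a≢c eq)
  injective (suc zero)       zero             eq = ⊥-elim (a≢b (sym eq))
  injective (suc zero)       (suc zero)       _  = refl
  injective (suc zero)       (suc (suc zero)) eq = ⊥-elim (b≢c eq)
  injective (suc (suc zero)) zero             eq = ⊥-elim (a≢c (sym eq))
  injective (suc (suc zero)) (suc zero)       eq = ⊥-elim (b≢c (sym eq))
  injective (suc (suc zero)) (suc (suc zero)) _  = refl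

rainbowZigzag : ∀ {n k} (c : Colouring n k) {a p q q′ : Fin n} →
  c a q ≢ c a q′ → c a q ≢ c p q′ → c a q′ ≢ c p q′ → Σ (Copy c P4) Rainbow
rainbowZigzag {n} {k} c {a} {p} {q} {q′} α≢β α≢γ β≢γ =
  rainbowPath c walk walk-injective colours (distinct-injective α≢β α≢γ β≢γ) coloured
  where
  colours : Fin 3 → Fin k
  colours = c a q ∷ c a q′ ∷ c p q′ ∷ []

  walk : Fin 4 → Fin n ⊎ Fin n
  walk = inj₂ q ∷ inj₁ a ∷ inj₂ q′ ∷ inj₁ p ∷ []

  q≢q′ : q ≢ q′
  q≢q′ refl = α≢β refl

  a≢p : a ≢ p
  a≢p refl = β≢γ refl

  injective : ∀ x y → walk x ≡ walk y → x ≡ y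
  injective zero                   zero                   _    = refl
  injective zero                   (suc (suc zero))       refl = ⊥-elim (q≢q′ refl)
  injective (suc zero)             (suc zero)             _    = refl
  injective (suc zero)             (suc (suc (suc zero))) refl = ⊥-elim (a≢p refl)
  injective (suc (suc zero))       zero                   refl = ⊥-elim (q≢q′ refl)
  injective (suc (suc zero))       (suc (suc zero))       _    = refl
  injective (suc (suc (suc zero))) (suc zero)             refl = ⊥-elim (a≢p refl)
  injective (suc (suc (suc zero))) (suc (suc (suc zero))) _    = refl
  injective zero                   (suc zero)             ()
  injective zero                   (suc (suc (suc zero))) ()
  injective (suc zero)             zero                   ()
  injective (suc zero)             (suc (suc zero))       ()
  injective (suc (suc zero))       (suc zero)             ()
  injective (suc (suc zero))       (suc (suc (suc zero))) ()
  injective (suc (suc (suc zero))) zero                   ()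
  injective (suc (suc (suc zero))) (suc (suc zero))       ()

  walk-injective : Injective _≡_ _≡_ walk
  walk-injective {x} {y} = injective x y

  coloured : ∀ i → ColouredEdge c (walk (inject₁ i)) (walk (suc i)) (colours i)
  coloured zero             = refl
  coloured (suc zero)       = refl
  coloured (suc (suc zero)) = refl

Constant : {A B : Set} → (A → B) → Set
Constant f = ∀ x y → f x ≡ f y

NonConstant : {A B : Set} → (A → B) → Set
NonConstant f = ∃₂ λ x y → f x ≢ f y

constant? : ∀ {n k} (f : Fin n → Fin k) → Dec (Constant f)
constant? f = all? λ x → all? λ y → f x ≟ f y

¬constant⇒nonConstant : ∀ {n k} (f : Fin n → Fin k) → ¬ Constant f → NonConstant f
¬constant⇒nonConstant {n} f ¬const with ¬∀⟶∃¬ n _ (λ x → all? λ y → f x ≟ f y) ¬const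
... | x , ¬∀y with ¬∀⟶∃¬ n _ (λ y → f x ≟ f y) ¬∀y
...   | y , fx≢fy = x , y , fx≢fy

≢-cotransitive : {A : Set} → DecidableEquality A → {x y : A} → x ≢ y → ∀ z → x ≢ z ⊎ z ≢ y
≢-cotransitive _≟_ {x} x≢y z with x ≟ z
... | yes refl = inj₂ x≢y
... | no x≢z   = inj₁ x≢z

nonConstant-avoids : ∀ {n k} {f : Fin n → Fin k} → NonConstant f → ∀ b → ∃[ z ] f z ≢ b
nonConstant-avoids (x , y , fx≢fy) b with ≢-cotransitive _≟_ fx≢fy b
... | inj₁ fx≢b = x , fx≢b
... | inj₂ b≢fy = y , λ fy≡b → b≢fy (sym fy≡b)

thirdColour : ∀ {k} → 3 ≤ k → (g d : Fin k) → ∃[ e ] e ≢ g × e ≢ d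
thirdColour (s≤s (s≤s (s≤s _))) g d with zero ≟ g | zero ≟ d
... | no 0≢g   | no 0≢d = zero , 0≢g , 0≢d
... | yes refl | _      with ≢-cotransitive _≟_ (λ ()) d
...   | inj₁ 1≢d = suc zero , (λ ()) , 1≢d
...   | inj₂ d≢2 = suc (suc zero) , (λ ()) , λ 2≡d → d≢2 (sym 2≡d)
thirdColour (s≤s (s≤s (s≤s _))) g d | no _ | yes refl with ≢-cotransitive _≟_ (λ ()) g
...   | inj₁ 1≢g = suc zero , 1≢g , (λ ())
...   | inj₂ g≢2 = suc (suc zero) , (λ 2≡g → g≢2 (sym 2≡g)) , (λ ())

-- With γ = c a y, the path q₁–a–y–p₁ is rainbow unless its end colours agree; in that case an
-- edge pq of a colour ε ∉ {γ, c a q₁} gives a rainbow path through row a whatever c a q is.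
nonConstantRowAndColumn⇒rainbowP4 : ∀ {n k} (c : Colouring n k) → 3 ≤ k → Exact c → {a y : Fin n} →
  NonConstant (c a) → NonConstant (transpose c y) → Σ (Copy c P4) Rainbow
nonConstantRowAndColumn⇒rainbowP4 c 3≤k ex {a} {y} row col
  with nonConstant-avoids row (c a y) | nonConstant-avoids col (c a y)
... | q₁ , α≢γ | p₁ , β≢γ with c a q₁ ≟ c p₁ y
...   | no α≢β = rainbowZigzag c α≢γ α≢β (λ γ≡β → β≢γ (sym γ≡β))
...   | yes α≡β with thirdColour 3≤k (c a y) (c a q₁)
...     | ε , ε≢γ , ε≢α with ex ε
...       | p , q , cpq≡ε with c a q ≟ ε | c a q ≟ c a y
...         | yes caq≡ε | _ =
  rainbowZigzag c (λ caq≡γ → ε≢γ (trans (sym caq≡ε) caq≡γ))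
                  (λ caq≡β → ε≢α (trans (sym caq≡ε) (trans caq≡β (sym α≡β))))
                  (λ γ≡β → β≢γ (sym γ≡β))
...         | no caq≢ε | yes caq≡γ =
  rainbowZigzag c (λ α≡caq → α≢γ (trans α≡caq caq≡γ))
                  (λ α≡cpq → ε≢α (sym (trans α≡cpq cpq≡ε)))
                  (λ caq≡cpq → caq≢ε (trans caq≡cpq cpq≡ε))
...         | no caq≢ε | no caq≢γ =
  rainbowZigzag c (λ γ≡caq → caq≢γ (sym γ≡caq))
                  (λ γ≡cpq → ε≢γ (sym (trans γ≡cpq cpq≡ε)))
                  (λ caq≡cpq → caq≢ε (trans caq≡cpq cpq≡ε))

monochromaticRow⇒monochromatic : ∀ {n k} (c : Colouring n k) {H : Graph} → SubgraphOfStar H k →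
  k ≤ n → {i : Fin n} {col : Fin k} → (∀ j → c i j ≡ col) → Σ (Copy c H) Monochromatic
monochromaticRow⇒monochromatic {n} {k} c {H} (f , f-inj , f-edge) k≤n {i} {col} row =
  copy , col , λ _ → refl
  where
  star : Fin (suc k) → Fin n ⊎ Fin n
  star zero    = inj₁ i
  star (suc l) = inj₂ (inject≤ l k≤n)

  star-injective : ∀ s t → star s ≡ star t → s ≡ t
  star-injective zero    zero    _  = refl
  star-injective (suc s) (suc t) eq = cong suc (inject≤-injective k≤n k≤n s t (inj₂-injective eq))

  star-edge : ∀ s t → StarEdge k s t → ColouredEdge c (star s) (star t) col
  star-edge zero    (suc t) _                  = row _
  star-edge (suc s) zero    _                  = row _
  star-edge zero    zero    (inj₁ (_ , t≢0))   = ⊥-elim (t≢0 refl)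
  star-edge zero    zero    (inj₂ (s≢0 , _))   = ⊥-elim (s≢0 refl)
  star-edge (suc s) (suc t) (inj₁ (() , _))
  star-edge (suc s) (suc t) (inj₂ (_ , ()))

  copy : Copy c H
  copy = record
    { map    = λ u → star (f u)
    ; inj    = λ {u} {v} eq → f-inj (star-injective (f u) (f v) eq)
    ; colour = λ _ → col
    ; isEdge = λ {u} {v} e → star-edge (f u) (f v) (f-edge e)
    }

constantRows⇒≤ : ∀ {n k} {c : Colouring n k} → Exact c → (∀ i → Constant (c i)) → k ≤ n
constantRows⇒≤ {n} {k} {c} ex rows = injective⇒≤ row-injective
  where
  row column : Fin k → Fin n
  row    col = proj₁ (ex col)
  column col = proj₁ (proj₂ (ex col))

  coloured : ∀ col → c (row col) (column col) ≡ col
  coloured col = proj₂ (proj₂ (ex col))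

  row-injective : Injective _≡_ _≡_ row
  row-injective {x} {y} eq = begin
    x                     ≡⟨ coloured x ⟨
    c (row x) (column x)  ≡⟨ rows (row x) (column x) (column y) ⟩
    c (row x) (column y)  ≡⟨ cong (λ r → c r (column y)) eq ⟩
    c (row y) (column y)  ≡⟨ coloured y ⟩
    y                     ∎
    where open ≡-Reasoning

constantRows⇒monochromatic : ∀ {n k} {c : Colouring n k} {H : Graph} → SubgraphOfStar H k →
  Exact c → (∀ i → Constant (c i)) → Fin n → Σ (Copy c H) Monochromatic
constantRows⇒monochromatic {c = c} H⊆K₁ₖ ex rows i =
  monochromaticRow⇒monochromatic c H⊆K₁ₖ (constantRows⇒≤ ex rows) (λ j → rows i j i)

arrows : ∀ {n k} → 3 ≤ k → (H : Graph) → SubgraphOfStar H k → Arrows n k P4 H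
arrows 3≤k@(s≤s _) H H⊆K₁ₖ c ex
  with all? (λ i → constant? (c i)) | all? (λ j → constant? (transpose c j))
... | yes rows | _ =
  inj₂ (constantRows⇒monochromatic H⊆K₁ₖ ex rows (proj₁ (ex zero)))
... | no _ | yes columns =
  inj₂ (transpose-monochromatic
         (constantRows⇒monochromatic H⊆K₁ₖ (transpose-exact ex) columns (proj₁ (ex zero))))
arrows 3≤k H H⊆K₁ₖ c ex | no ¬rows | no ¬columns
  with ¬∀⟶∃¬ _ _ (λ i → constant? (c i)) ¬rows | ¬∀⟶∃¬ _ _ (λ j → constant? (transpose c j)) ¬columns
... | a , ¬row | y , ¬column =
  inj₁ (nonConstantRowAndColumn⇒rainbowP4 c 3≤k ex
         (¬constant⇒nonConstant (c a) ¬row) (¬constant⇒nonConstant (transpose c y) ¬column))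

ceilSqrt-least : ∀ {k N M} → IsCeilSqrt k N → k ≤ M * M → N ≤ M
ceilSqrt-least (below , _) k≤M² = ≮⇒≥ λ M<N →
  <⇒≱ below (≤-trans k≤M² (*-mono-≤ (<⇒≤pred M<N) (<⇒≤pred M<N)))

theorem4p1 : (k : ℕ) → 3 ≤ k → (H : Graph) → SubgraphOfStar H k →
    (N : ℕ) → IsCeilSqrt k N → IsBgr k P4 H N
theorem4p1 k 3≤k H H⊆K₁ₖ N ceil =
  proj₂ ceil , (λ _ _ → arrows 3≤k H H⊆K₁ₖ) , (λ _ k≤M² _ → ceilSqrt-least ceil k≤M²)
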